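{- Let $n \ge 1$ and let $\mathcal{A} \subseteq \mathbb{Z}^{n+1}$ be a finite set of pairs $(a,a_0)$ with $a \in \mathbb{Z}^n\setminus\{0\}$ and $a_0 \in \mathbb{Z}$, and let $m = |\mathcal{A}|$. Then there exists $y \in \mathbb{Z}^n$ with $a^\top y \neq a_0$ for all $(a,a_0)\in\mathcal{A}$ and $\|y\|_1 \leq (m+n)/2$. -}

module Defs where

open import Data.Nat as ℕ using (ℕ)
open import Data.Integer using (ℤ; +_; ∣_∣; _+_; _*_)
open import Data.Vec using (Vec; zipWith; foldr; map; replicate)

dot : ∀ {n} → Vec ℤ n → Vec ℤ n → ℤ
dot a y = foldr _ _+_ (+ 0) (zipWith _*_ a y)

norm1 : ∀ {n} → Vec ℤ n → ℕ
norm1 y = foldr _ ℕ._+_ 0 (map ∣_∣ y)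

zeroVec : ∀ n → Vec ℤ n
zeroVec n = replicate n (+ 0)

-- The equations whose first coefficient vanishes do not involve
-- y₁, so by induction some y′ ∈ ℤⁿ⁻¹ avoids them with 2‖y′‖₁ ≤ m₀ + n − 1,
-- where m₀ is their number. With y′ fixed, each of the other m − m₀ equations
-- has a nonzero coefficient of y₁ and so holds for at most one value of y₁;
-- by pigeonhole one of the m − m₀ + 1 integers 0, −1, 1, −2, 2, … avoids
-- them all, and its absolute value is at most (m − m₀ + 1)/2.
module Submission where

open import Defs
open import Data.Empty using (⊥-elim)
open import Data.Fin using (Fin; toℕ)
open import Data.Fin.Properties using (any?; pigeonhole; toℕ<n)
open import Data.Integer as ℤ using (ℤ; +_; -[1+_]; ∣_∣; ≢-nonZero)
open import Data.Integer.Properties using (*-cancelˡ-≡; +-identityˡ; +-0-abelianGroup)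
open import Algebra.Properties.AbelianGroup +-0-abelianGroup using (∙-cancelʳ)
open import Data.List using (List; []; _∷_; length; lookup)
open import Data.List.Relation.Unary.All as All using (All; []; _∷_; all?; lookupAny)
open import Data.List.Relation.Unary.All.Properties using (¬All⇒Any¬)
open import Data.List.Relation.Unary.Any as Any using (Any; index)
open import Data.List.Relation.Unary.Any.Properties using (lookup-result)
open import Data.List.Relation.Unary.Unique.Propositional using (Unique)
open import Data.Nat using (ℕ; zero; suc; _≤_; _+_; _*_; z≤n; s≤s; s≤s⁻¹)
open import Data.Nat.Properties
  using (≤-trans; ≤-reflexive; n≤1+n; n<1+n; *-suc; *-distribˡ-+; +-mono-≤; +-suc; <-irrefl; module ≤-Reasoning)
open import Data.Product using (_×_; _,_; ∃; proj₁; proj₂)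
open import Data.Vec using (Vec; []; _∷_; head)
open import Function using (Injective)
open import Relation.Binary.PropositionalEquality using (_≡_; _≢_; refl; sym; trans; cong; subst)
open import Relation.Nullary using (¬_; Dec; yes; no; ¬?)
open import Relation.Nullary.Decidable using (decidable-stable)
open import Data.Nat.Tactic.RingSolver using (solve-∀)

awayFromZero : ℤ → ℤ
awayFromZero (+ n) = + suc n
awayFromZero -[1+ n ] = -[1+ suc n ]

zigzag : ℕ → ℤ
zigzag 0 = + 0
zigzag 1 = -[1+ 0 ]
zigzag (suc (suc k)) = awayFromZero (zigzag k)

unzigzag : ℤ → ℕ
unzigzag (+ n) = 2 * n
unzigzag -[1+ n ] = suc (2 * n)

unzigzag-awayFromZero : ∀ x → unzigzag (awayFromZero x) ≡ 2 + unzigzag x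
unzigzag-awayFromZero (+ n) = *-suc 2 n
unzigzag-awayFromZero -[1+ n ] = cong suc (*-suc 2 n)

unzigzag-zigzag : ∀ k → unzigzag (zigzag k) ≡ k
unzigzag-zigzag 0 = refl
unzigzag-zigzag 1 = refl
unzigzag-zigzag (suc (suc k)) =
  trans (unzigzag-awayFromZero (zigzag k)) (cong (λ m → 2 + m) (unzigzag-zigzag k))

zigzag-injective : Injective _≡_ _≡_ zigzag
zigzag-injective {i} {j} eq =
  trans (sym (unzigzag-zigzag i)) (trans (cong unzigzag eq) (unzigzag-zigzag j))

2∣x∣≤1+unzigzag : ∀ x → 2 * ∣ x ∣ ≤ suc (unzigzag x)
2∣x∣≤1+unzigzag (+ n) = n≤1+n (2 * n)
2∣x∣≤1+unzigzag -[1+ n ] = ≤-reflexive (*-suc 2 n)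

2∣zigzag∣≤1+ : ∀ k → 2 * ∣ zigzag k ∣ ≤ suc k
2∣zigzag∣≤1+ k =
  subst (λ m → 2 * ∣ zigzag k ∣ ≤ suc m) (unzigzag-zigzag k) (2∣x∣≤1+unzigzag (zigzag k))

AtMostOne : ∀ {A : Set} → (A → Set) → Set
AtMostOne P = ∀ {a a′} → P a → P a′ → a ≡ a′

module _ {X A : Set} (Hits : X → A → Set) (hits? : ∀ p a → Dec (Hits p a)) where

  ¬All¬⇒Any : ∀ a ps → ¬ All (λ p → ¬ Hits p a) ps → Any (λ p → Hits p a) ps
  ¬All¬⇒Any a ps notAllMiss =
    Any.map (decidable-stable (hits? _ a)) (¬All⇒Any¬ (λ p → ¬? (hits? p a)) ps notAllMiss)

  ¬hitAll : (c : ℕ → A) → Injective _≡_ _≡_ c →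
            (ps : List X) → All (λ p → AtMostOne (Hits p)) ps →
            ¬ (∀ (k : Fin (suc (length ps))) → Any (λ p → Hits p (c (toℕ k))) ps)
  ¬hitAll c c-injective ps atMostOne hit
    with i , j , i<j , same-index ← pigeonhole (n<1+n (length ps)) (λ k → index (hit k))
    with atMostOne-i , hit-i ← lookupAny atMostOne (hit i)
    = <-irrefl (c-injective (atMostOne-i hit-i hit-j)) i<j
    where
      hit-j : Hits (lookup ps (index (hit i))) (c (toℕ j))
      hit-j = subst (λ t → Hits (lookup ps t) (c (toℕ j))) (sym same-index)
                (lookup-result (hit j))

  escape : (c : ℕ → A) → Injective _≡_ _≡_ c →
           (ps : List X) → All (λ p → AtMostOne (Hits p)) ps →
           ∃ λ k → k ≤ length ps × All (λ p → ¬ Hits p (c k)) ps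
  escape c c-injective ps atMostOne
    with any? {n = suc (length ps)} (λ k → all? (λ p → ¬? (hits? p (c (toℕ k)))) ps)
  ... | yes (k , missed) = toℕ k , s≤s⁻¹ (toℕ<n k) , missed
  ... | no noneMissed = ⊥-elim (¬hitAll c c-injective ps atMostOne
          (λ k → ¬All¬⇒Any (c (toℕ k)) ps (λ missed → noneMissed (k , missed))))

escapeNearZero : ∀ {X : Set} (Hits : X → ℤ → Set) (hits? : ∀ p x → Dec (Hits p x)) →
                 (ps : List X) → All (λ p → AtMostOne (Hits p)) ps →
                 ∃ λ x → All (λ p → ¬ Hits p x) ps × 2 * ∣ x ∣ ≤ suc (length ps)
escapeNearZero Hits hits? ps atMostOne
  with k , k≤len , missed ← escape Hits hits? zigzag zigzag-injective ps atMostOne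
  = zigzag k , missed , ≤-trans (2∣zigzag∣≤1+ k) (s≤s k≤len)

Equation : ℕ → Set
Equation n = Vec ℤ n × ℤ

_avoids_ : ∀ {n} → Vec ℤ n → Equation n → Set
y avoids e = dot (proj₁ e) y ≢ proj₂ e

Nondegenerate : ∀ n → Equation n → Set
Nondegenerate n e = proj₁ e ≢ zeroVec n

affine-injective : ∀ {a} → a ≢ + 0 → ∀ s {x x′} → a ℤ.* x ℤ.+ s ≡ a ℤ.* x′ ℤ.+ s → x ≡ x′
affine-injective {a} a≢0 s {x} {x′} eq =
  *-cancelˡ-≡ a x x′ {{≢-nonZero a≢0}} (∙-cancelʳ s (a ℤ.* x) (a ℤ.* x′) eq)

solvesFor-y₀ : ∀ {n} → Vec ℤ n → Equation (suc n) → ℤ → Set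
solvesFor-y₀ y e y₀ = dot (proj₁ e) (y₀ ∷ y) ≡ proj₂ e

solvesFor-y₀? : ∀ {n} (y : Vec ℤ n) e y₀ → Dec (solvesFor-y₀ y e y₀)
solvesFor-y₀? y e y₀ = dot (proj₁ e) (y₀ ∷ y) ℤ.≟ proj₂ e

solvesFor-y₀-atMostOne : ∀ {n} (y : Vec ℤ n) (e : Equation (suc n)) →
                         head (proj₁ e) ≢ + 0 → AtMostOne (solvesFor-y₀ y e)
solvesFor-y₀-atMostOne y (a ∷ as , b) a≢0 solves solves′ =
  affine-injective a≢0 (dot as y) (trans solves (sym solves′))

record SplitByHead {n} (E : List (Equation (suc n))) : Set where
  field
    zeroHead : List (Equation n)
    nonzeroHead : List (Equation (suc n))
    length-≡ : length zeroHead + length nonzeroHead ≡ length E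
    zeroHead-nondegenerate : All (Nondegenerate n) zeroHead
    nonzeroHead-head≢0 : All (λ e → head (proj₁ e) ≢ + 0) nonzeroHead
    avoids-merge : ∀ y₀ y → All (y avoids_) zeroHead → All ((y₀ ∷ y) avoids_) nonzeroHead →
                   All ((y₀ ∷ y) avoids_) E

splitByHead : ∀ {n} (E : List (Equation (suc n))) → All (Nondegenerate (suc n)) E → SplitByHead E
splitByHead [] [] = record
  { zeroHead = [] ; nonzeroHead = [] ; length-≡ = refl
  ; zeroHead-nondegenerate = [] ; nonzeroHead-head≢0 = [] ; avoids-merge = λ _ _ _ _ → [] }
splitByHead ((a ∷ as , b) ∷ E) (nondeg ∷ nondegs) with splitByHead E nondegs | a ℤ.≟ + 0
... | split | yes refl = record
  { zeroHead = (as , b) ∷ zeroHead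
  ; nonzeroHead = nonzeroHead
  ; length-≡ = cong suc length-≡
  ; zeroHead-nondegenerate = (λ as≡0 → nondeg (cong (+ 0 ∷_) as≡0)) ∷ zeroHead-nondegenerate
  ; nonzeroHead-head≢0 = nonzeroHead-head≢0
  ; avoids-merge = λ { y₀ y (avoids ∷ avoidsZ) avoidsN →
      (λ solves → avoids (trans (sym (+-identityˡ (dot as y))) solves))
        ∷ avoids-merge y₀ y avoidsZ avoidsN }
  }
  where open SplitByHead split
... | split | no a≢0 = record
  { zeroHead = zeroHead
  ; nonzeroHead = (a ∷ as , b) ∷ nonzeroHead
  ; length-≡ = trans (+-suc (length zeroHead) (length nonzeroHead)) (cong suc length-≡)
  ; zeroHead-nondegenerate = zeroHead-nondegenerate
  ; nonzeroHead-head≢0 = a≢0 ∷ nonzeroHead-head≢0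
  ; avoids-merge = λ { y₀ y avoidsZ (avoids ∷ avoidsN) → avoids ∷ avoids-merge y₀ y avoidsZ avoidsN }
  }
  where open SplitByHead split

2*[u+v]≤ : ∀ u v {c d n} → 2 * u ≤ suc d → 2 * v ≤ c + n →
           2 * (u + v) ≤ (c + d) + suc n
2*[u+v]≤ u v {c} {d} {n} 2u≤ 2v≤ = begin
  2 * (u + v)      ≡⟨ *-distribˡ-+ 2 u v ⟩
  2 * u + 2 * v    ≤⟨ +-mono-≤ 2u≤ 2v≤ ⟩
  suc d + (c + n)  ≡⟨ rearrange c d n ⟩
  (c + d) + suc n  ∎
  where
    open ≤-Reasoning
    rearrange : ∀ c d n → suc d + (c + n) ≡ (c + d) + suc n
    rearrange = solve-∀

avoidAll : ∀ n (E : List (Equation n)) → All (Nondegenerate n) E →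
           ∃ λ (y : Vec ℤ n) → All (y avoids_) E × 2 * norm1 y ≤ length E + n
avoidAll zero [] [] = [] , [] , z≤n
avoidAll zero (([] , _) ∷ _) (nondeg ∷ _) = ⊥-elim (nondeg refl)
avoidAll (suc n) E nondeg =
  let (y , y-avoids , y-small) = avoidAll n zeroHead zeroHead-nondegenerate
      (y₀ , y₀-avoids , y₀-small) = escapeNearZero (solvesFor-y₀ y) (solvesFor-y₀? y) nonzeroHead
                                      (All.map (λ {e} → solvesFor-y₀-atMostOne y e) nonzeroHead-head≢0)
  in y₀ ∷ y , avoids-merge y₀ y y-avoids y₀-avoids ,
     subst (λ len → 2 * norm1 (y₀ ∷ y) ≤ len + suc n) length-≡
           (2*[u+v]≤ ∣ y₀ ∣ (norm1 y) y₀-small y-small)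
  where open SplitByHead (splitByHead E nondeg)

proposition3 : (n : ℕ) → 1 ≤ n → (𝒜 : List (Vec ℤ n × ℤ)) → Unique 𝒜 →
    All (λ p → proj₁ p ≢ zeroVec n) 𝒜 →
    ∃ λ (y : Vec ℤ n) →
    All (λ p → dot (proj₁ p) y ≢ proj₂ p) 𝒜
    × 2 * norm1 y ≤ length 𝒜 + n
proposition3 n _ 𝒜 _ = avoidAll n 𝒜
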